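{- Let $G$ be an irreflexive oriented graph with maximum in-degree at most two and maximum out-degree at most two such that none of $H_4$, $H_4^c$, $X_2$ has an ios-injective homomorphism to $G$. Then the Consistency Check Algorithm succeeds when run on $G$ if and only if $G$ has an ios-injective homomorphism to $T_2^r$.
   Context: $T_2^r$ has vertices $t_0,t_1$, a loop at each, and the arc $t_0t_1$. A homomorphism is ios-injective if for every vertex $x$ it is injective on the in-neighbourhood $N^-(x)$ and on the out-neighbourhood $N^+(x)$. $H_4$ has arcs $h_0h_3,h_1h_3,h_2h_3$; $H_4^c$ is its converse; $X_2$ is the orientation of $K_{1,4}$ whose centre has in-degree 2 and out-degree 2. Consistency Check Algorithm on an oriented graph $G$ with arc set $E$: each vertex $x$ gets a list $\ell(x)\subseteq\{t_0,t_1\}$, initialized to $\{t_0\}$ if $x$ has out-degree 2, to $\{t_1\}$ if $x$ has in-degree 2, and to $\{t_0,t_1\}$ otherwise. Then repeat the following rules until some list becomes empty or no list changes: (1) if $\ell(y)=\{t_0\}$ and $xy\in E$, remove $t_1$ from $\ell(x)$; (2) if $\ell(y)=\{t_1\}$ and $yx\in E$, remove $t_0$ from $\ell(x)$; (3) if $\ell(y)=\{c\}$ and, for some vertex $s$, either $xs,ys\in E$ or $sx,sy\in E$ (with $x\neq y$), remove $c$ from $\ell(x)$. The algorithm succeeds if it terminates with no list empty, and fails otherwise. -}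

module Defs where

open import Data.Nat using (ℕ; _≤_; _≡ᵇ_)
open import Data.Fin using (Fin; zero; suc; _≟_)
open import Data.Fin.Patterns using (0F; 1F; 2F; 3F; 4F)
open import Data.Bool using (Bool; true; false; T; if_then_else_; _∧_)
open import Data.List using (length; filterᵇ)
open import Data.List using () renaming (allFin to allFinL)
open import Data.Product using (Σ; ∃; _×_; _,_)
open import Data.Sum using (_⊎_)
open import Relation.Nullary using (¬_; does)
open import Relation.Binary.PropositionalEquality using (_≡_; _≢_)
open import Relation.Binary.Construct.Closure.ReflexiveTransitive using (Star)

record Digraph : Set₁ where
  field
    V : Set
    E : V → V → Set
open Digraph public

record IosInjHom (G H : Digraph) : Set where
  field
    f     : V G → V H
    hom   : ∀ {x y} → E G x y → E H (f x) (f y)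
    inInj  : ∀ x y z → E G y x → E G z x → f y ≡ f z → y ≡ z
    outInj : ∀ x y z → E G x y → E G x z → f y ≡ f z → y ≡ z

-- T₂ʳ : t₀ = 0F, t₁ = 1F ; loops at both, arc t₀ t₁
T2r-arc : Fin 2 → Fin 2 → Bool
T2r-arc 0F 0F = true
T2r-arc 0F 1F = true
T2r-arc 1F 0F = false
T2r-arc 1F 1F = true

T2r : Digraph
T2r = record { V = Fin 2 ; E = λ x y → T (T2r-arc x y) }

H4-arc : Fin 4 → Fin 4 → Bool
H4-arc 0F 3F = true
H4-arc 1F 3F = true
H4-arc 2F 3F = true
H4-arc _  _  = false

H4 : Digraph
H4 = record { V = Fin 4 ; E = λ x y → T (H4-arc x y) }

H4c : Digraph
H4c = record { V = Fin 4 ; E = λ x y → T (H4-arc y x) }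

X2-arc : Fin 5 → Fin 5 → Bool
X2-arc 1F 0F = true
X2-arc 2F 0F = true
X2-arc 0F 3F = true
X2-arc 0F 4F = true
X2-arc _  _  = false

X2 : Digraph
X2 = record { V = Fin 5 ; E = λ x y → T (X2-arc x y) }

record FinDigraph : Set where
  field
    n   : ℕ
    arc : Fin n → Fin n → Bool
open FinDigraph public

toDigraph : FinDigraph → Digraph
toDigraph G = record { V = Fin (n G) ; E = λ x y → T (arc G x y) }

IrreflexiveOriented : FinDigraph → Set
IrreflexiveOriented G =
  (∀ x → arc G x x ≡ false) × (∀ x y → T (arc G x y) → arc G y x ≡ false)

outdeg : (G : FinDigraph) → Fin (n G) → ℕ
outdeg G x = length (filterᵇ (λ y → arc G x y) (allFinL (n G)))

indeg : (G : FinDigraph) → Fin (n G) → ℕ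
indeg G x = length (filterᵇ (λ y → arc G y x) (allFinL (n G)))

-- Consistency Check Algorithm
-- A state assigns to each vertex x a list ℓ(x) ⊆ {t₀,t₁}, represented
-- by its characteristic function: ℓ x c ≡ true iff c ∈ ℓ(x).

t₀ t₁ : Fin 2
t₀ = 0F
t₁ = 1F

other : Fin 2 → Fin 2
other 0F = 1F
other 1F = 0F

State : FinDigraph → Set
State G = Fin (n G) → Fin 2 → Bool

is : Fin 2 → Fin 2 → Bool
is c d = does (c ≟ d)

initial : (G : FinDigraph) → State G
initial G x c =
  if outdeg G x ≡ᵇ 2 then is c t₀
  else if indeg G x ≡ᵇ 2 then is c t₁
  else true

Singleton : {G : FinDigraph} → State G → Fin (n G) → Fin 2 → Set
Singleton ℓ y c = ℓ y c ≡ true × ℓ y (other c) ≡ false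

data Removable (G : FinDigraph) (ℓ : State G) : Fin (n G) → Fin 2 → Set where
  rule1 : ∀ x y → Singleton {G} ℓ y t₀ → T (arc G x y) → Removable G ℓ x t₁
  rule2 : ∀ x y → Singleton {G} ℓ y t₁ → T (arc G y x) → Removable G ℓ x t₀
  rule3 : ∀ x y s c → x ≢ y → Singleton {G} ℓ y c →
          (T (arc G x s) × T (arc G y s)) ⊎ (T (arc G s x) × T (arc G s y)) →
          Removable G ℓ x c

remove : {G : FinDigraph} → State G → Fin (n G) → Fin 2 → State G
remove ℓ x c y d = if does (y ≟ x) ∧ does (d ≟ c) then false else ℓ y d

NoEmpty : {G : FinDigraph} → State G → Set
NoEmpty {G} ℓ = ∀ (x : Fin (n G)) → ∃ λ c → ℓ x c ≡ true

data Step (G : FinDigraph) : State G → State G → Set where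
  step : ∀ ℓ x c → NoEmpty {G} ℓ → Removable G ℓ x c →
         Step G ℓ (remove {G} ℓ x c)

Stable : {G : FinDigraph} → State G → Set
Stable {G} ℓ = ∀ x c → Removable G ℓ x c → ℓ x c ≡ false

CCASucceeds : FinDigraph → Set
CCASucceeds G =
  Σ (State G) λ ℓ → Star (Step G) (initial G) ℓ × Stable {G} ℓ × NoEmpty {G} ℓ

module Submission where

-- The rules, and the initial lists (two out-neighbours force t₀, two in-neighbours force t₁),
-- only discard colours that an ios-injective homomorphism f to T₂ʳ agreeing with the current
-- lists cannot take. Every step shrinks a list, so a run keeping f admissible ends in a stable
-- state in which every list still contains f x.
--
-- Conversely, in a stable state without empty lists a vertex with a singleton list gets its
-- colour. A full vertex, whose list is still {t₀, t₁}, has in- and out-degree at most one, and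
-- stability leaves two kinds of constraint between full vertices: equal colours along an arc,
-- different colours for two of them sharing an out- or in-neighbour with a singleton list.
-- Attached to the out-side and in-side ("ports") of the full vertices, these constraints form a
-- partial successor on ports that commutes with swapping the two ports of a vertex and never
-- leads from a port to its twin. Such a successor has a 2-colouring of the ports, constant along
-- steps and opposite on twins: eliminate the vertices one by one, short-cutting every step
-- through the eliminated vertex, and colour its ports from the ports its steps lead to.

open import Defs
open import Data.Bool using (Bool; true; false; T; not; if_then_else_; _∧_)
import Data.Bool.Properties as Bool
open import Data.Empty using (⊥; ⊥-elim)
open import Data.Fin using (Fin; zero; suc; _≟_)
open import Data.Fin.Patterns using (0F; 1F)
open import Data.Fin.Properties using (any?; all?)
open import Data.List using (List; []; _∷_; length; filterᵇ; allFin)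
open import Data.List.Membership.Propositional using (_∈_)
open import Data.List.Membership.Propositional.Properties
  using (∈-allFin; ∈-filter⁺; ∈-filter⁻; ∈-length)
open import Data.List.Relation.Unary.Any using (here; there)
open import Data.List.Relation.Unary.AllPairs using (_∷_)
open import Data.List.Relation.Unary.All using (_∷_)
open import Data.List.Relation.Unary.Unique.Propositional using (Unique)
open import Data.List.Relation.Unary.Unique.Propositional.Properties using (allFin⁺; filter⁺)
open import Data.Maybe using (Maybe; just; nothing; maybe′)
open import Data.Maybe.Properties using (just-injective)
open import Data.Nat using (ℕ; zero; suc; _+_; _≤_; _<_; z≤n; s≤s; _≡ᵇ_)
open import Data.Nat.Induction using (<-wellFounded)
open import Data.Nat.Properties
  using (≤-refl; ≤-antisym; +-mono-≤; +-mono-<-≤; +-mono-≤-<; m≤n⇒m≤1+n; ≡ᵇ⇒≡; ≡⇒≡ᵇ; ≤⇒≯)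
open import Data.Product using (Σ; ∃; ∃₂; _×_; _,_; proj₁; proj₂)
open import Data.Sum using (_⊎_; inj₁; inj₂)
open import Data.Unit using (tt)
open import Function using (_∘_)
open import Function.Bundles using (_⇔_; mk⇔)
open import Induction.WellFounded using (Acc; acc)
open import Relation.Binary.Definitions using (DecidableEquality)
open import Relation.Binary.Construct.Closure.ReflexiveTransitive using (Star; ε; _◅_)
open import Relation.Binary.PropositionalEquality
open import Relation.Nullary using (¬_; Dec; yes; no; does; contradiction)
open import Relation.Nullary.Decidable using (T?; _×-dec_; _⊎-dec_; ¬?)
import Relation.Nullary.Decidable as Dec

two≤length : ∀ {A : Set} {a b : A} {xs : List A} → a ∈ xs → b ∈ xs → a ≢ b → 2 ≤ length xs
two≤length (here refl) (here refl) a≢b = contradiction refl a≢b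
two≤length (here _)    (there b∈)  _   = s≤s (∈-length b∈)
two≤length (there a∈)  (here _)    _   = s≤s (∈-length a∈)
two≤length (there a∈)  (there b∈)  a≢b = m≤n⇒m≤1+n (two≤length a∈ b∈ a≢b)

three≤length : ∀ {A : Set} {a b c : A} {xs : List A} → a ∈ xs → b ∈ xs → c ∈ xs →
               a ≢ b → a ≢ c → b ≢ c → 3 ≤ length xs
three≤length (here refl) (here refl) _ a≢b _ _ = contradiction refl a≢b
three≤length (here refl) _ (here refl) _ a≢c _ = contradiction refl a≢c
three≤length _ (here refl) (here refl) _ _ b≢c = contradiction refl b≢c
three≤length (here _)   (there b∈) (there c∈) _   _   b≢c = s≤s (two≤length b∈ c∈ b≢c)
three≤length (there a∈) (here _)   (there c∈) _   a≢c _   = s≤s (two≤length a∈ c∈ a≢c)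
three≤length (there a∈) (there b∈) (here _)   a≢b _   _   = s≤s (two≤length a∈ b∈ a≢b)
three≤length (there a∈) (there b∈) (there c∈) a≢b a≢c b≢c =
  m≤n⇒m≤1+n (three≤length a∈ b∈ c∈ a≢b a≢c b≢c)

length≡2⇒two-members : ∀ {A : Set} {xs : List A} → Unique xs → length xs ≡ 2 →
                       ∃₂ λ a b → a ≢ b × a ∈ xs × b ∈ xs
length≡2⇒two-members {xs = a ∷ b ∷ []} ((a≢b ∷ _) ∷ _) _ = a , b , a≢b , here refl , there (here refl)

module _ {m : ℕ} (p : Fin m → Bool) where

  Selected : List (Fin m)
  Selected = filterᵇ p (allFin m)

  ∈-selected : ∀ {a} → T (p a) → a ∈ Selected
  ∈-selected pa = ∈-filter⁺ (T? ∘ p) (∈-allFin _) pa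

  selected-satisfies : ∀ {a} → a ∈ Selected → T (p a)
  selected-satisfies a∈ = proj₂ (∈-filter⁻ (T? ∘ p) {xs = allFin m} a∈)

  selected-unique : Unique Selected
  selected-unique = filter⁺ (T? ∘ p) (allFin⁺ m)

∑ : ∀ {m} → (Fin m → ℕ) → ℕ
∑ {zero}  f = 0
∑ {suc m} f = f zero + ∑ (f ∘ suc)

∑-mono-≤ : ∀ {m} {f g : Fin m → ℕ} → (∀ i → f i ≤ g i) → ∑ f ≤ ∑ g
∑-mono-≤ {zero}  _   = z≤n
∑-mono-≤ {suc m} f≤g = +-mono-≤ (f≤g zero) (∑-mono-≤ (f≤g ∘ suc))

∑-mono-< : ∀ {m} {f g : Fin m → ℕ} → (∀ i → f i ≤ g i) → ∀ j → f j < g j → ∑ f < ∑ g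
∑-mono-< f≤g zero    f<g = +-mono-<-≤ f<g (∑-mono-≤ (f≤g ∘ suc))
∑-mono-< f≤g (suc j) f<g = +-mono-≤-< (f≤g zero) (∑-mono-< (f≤g ∘ suc) j f<g)

true≢false : true ≢ false
true≢false ()

⟦_⟧ : Bool → ℕ
⟦ b ⟧ = if b then 1 else 0

≡ᵇ-true : ∀ {m k} → (m ≡ᵇ k) ≡ true → m ≡ k
≡ᵇ-true {m} {k} e = ≡ᵇ⇒≡ m k (subst T (sym e) tt)

≡ᵇ-false : ∀ {m k} → (m ≡ᵇ k) ≡ false → m ≢ k
≡ᵇ-false {m} {k} e m≡k = subst T e (≡⇒≡ᵇ m k m≡k)

is-false : ∀ {c d} → is c d ≡ false → c ≢ d
is-false {c} {d} e with c ≟ d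
... | no c≢d = c≢d

≢⇒≡other : ∀ {c d : Fin 2} → c ≢ d → c ≡ other d
≢⇒≡other {0F} {0F} c≢d = contradiction refl c≢d
≢⇒≡other {0F} {1F} _   = refl
≢⇒≡other {1F} {0F} _   = refl
≢⇒≡other {1F} {1F} c≢d = contradiction refl c≢d

t[_] : Bool → Fin 2
t[ true  ] = t₀
t[ false ] = t₁

t[]-injective : ∀ {b b′} → t[ b ] ≡ t[ b′ ] → b ≡ b′
t[]-injective {true}  {true}  _ = refl
t[]-injective {false} {false} _ = refl

≢t[]⇒≡t[not] : ∀ b {c} → c ≢ t[ b ] → c ≡ t[ not b ]
≢t[]⇒≡t[not] true  = ≢⇒≡other
≢t[]⇒≡t[not] false = ≢⇒≡other

T2r-no-t₁t₀ : ∀ {c d} → c ≡ t₁ → d ≡ t₀ → ¬ T (T2r-arc c d)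
T2r-no-t₁t₀ refl refl ()

T2r-arc-unless-t₁t₀ : ∀ {c d} → (c ≡ t₁ → d ≢ t₀) → T (T2r-arc c d)
T2r-arc-unless-t₁t₀ {0F} {0F} _ = tt
T2r-arc-unless-t₁t₀ {0F} {1F} _ = tt
T2r-arc-unless-t₁t₀ {1F} {0F} h = contradiction refl (h refl)
T2r-arc-unless-t₁t₀ {1F} {1F} _ = tt

module PortColouring {V : Set} (_≟_ : DecidableEquality V) where

  Port : Set
  Port = V × Bool

  opposite : Port → Port
  opposite (x , b) = x , not b

  opposite-involutive : ∀ q → opposite (opposite q) ≡ q
  opposite-involutive (x , b) = cong (x ,_) (Bool.not-involutive b)

  Successor : Set
  Successor = Port → Maybe Port

  Reversible : Successor → Set
  Reversible s = ∀ {q p} → s q ≡ just p → s (opposite p) ≡ just (opposite q)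

  NoUTurn : Successor → Set
  NoUTurn s = ∀ q → s q ≢ just (opposite q)

  opposite-irreflexive : ∀ q → q ≢ opposite q
  opposite-irreflexive (x , true)  ()
  opposite-irreflexive (x , false) ()

  record Colouring (_↝_ : Port → Port → Set) : Set where
    field
      colour          : Port → Bool
      colour-opposite : ∀ q → colour (opposite q) ≡ not (colour q)
      colour-step     : ∀ {q p} → q ↝ p → colour p ≡ colour q

  Graph : Successor → Port → Port → Set
  Graph s q p = s q ≡ just p

  module Bypass (v : V) (s : Successor) where

    avoid : Maybe Port → Maybe Port
    avoid nothing  = nothing
    avoid (just r) = if does (proj₁ r ≟ v) then nothing else just r

    through : Maybe Port → Maybe Port
    through nothing  = nothing
    through (just r) = if does (proj₁ r ≟ v) then avoid (s r) else just r

    -- Steps from the ports of v are dropped and a step into v is continued by the step out of it.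
    bypass : Successor
    bypass q = if does (proj₁ q ≟ v) then nothing else through (s q)

    data Via (q p : Port) : Set where
      direct : s q ≡ just p → Via q p
      detour : ∀ {r} → s q ≡ just r → proj₁ r ≡ v → s r ≡ just p → Via q p

    via-source : ∀ {q p} → Via q p → ∃ λ r → s q ≡ just r
    via-source (direct e)     = _ , e
    via-source (detour e _ _) = _ , e

    avoid-just : ∀ {m p} → avoid m ≡ just p → m ≡ just p × proj₁ p ≢ v
    avoid-just {just r} e with proj₁ r ≟ v
    avoid-just {just r} refl | no r∉v = refl , r∉v

    avoid-off : ∀ {p} → proj₁ p ≢ v → avoid (just p) ≡ just p
    avoid-off {p} p∉v with proj₁ p ≟ v
    ... | yes p∈v = contradiction p∈v p∉v
    ... | no _    = refl

    through-off : ∀ {p} → proj₁ p ≢ v → through (just p) ≡ just p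
    through-off {p} p∉v with proj₁ p ≟ v
    ... | yes p∈v = contradiction p∈v p∉v
    ... | no _    = refl

    through-just : ∀ {q m p} → s q ≡ m → through m ≡ just p → Via q p × proj₁ p ≢ v
    through-just {m = just r} e t with proj₁ r ≟ v
    ... | yes r∈v = let e′ , p∉v = avoid-just t in detour e r∈v e′ , p∉v
    through-just {m = just r} e refl | no r∉v = direct e , r∉v

    bypass-just : ∀ {q p} → bypass q ≡ just p → proj₁ q ≢ v × Via q p × proj₁ p ≢ v
    bypass-just {q} e with proj₁ q ≟ v
    ... | no q∉v = q∉v , through-just refl e

    bypass-direct : ∀ {q p} → proj₁ q ≢ v → s q ≡ just p → proj₁ p ≢ v → bypass q ≡ just p
    bypass-direct {q} q∉v e p∉v with proj₁ q ≟ v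
    ... | yes q∈v = contradiction q∈v q∉v
    ... | no _ rewrite e = through-off p∉v

    bypass-detour : ∀ {q r p} → proj₁ q ≢ v → s q ≡ just r → proj₁ r ≡ v →
                    s r ≡ just p → proj₁ p ≢ v → bypass q ≡ just p
    bypass-detour {q} {r} q∉v e r∈v e′ p∉v with proj₁ q ≟ v
    ... | yes q∈v = contradiction q∈v q∉v
    ... | no _ rewrite e with proj₁ r ≟ v
    ...   | no r∉v = contradiction r∈v r∉v
    ...   | yes _ rewrite e′ = avoid-off p∉v

    module _ (reversible : Reversible s) (no-u-turn : NoUTurn s) where

      bypass-reversible : Reversible bypass
      bypass-reversible e with bypass-just e
      ... | q∉v , direct e′ , p∉v =
        bypass-direct p∉v (reversible e′) q∉v
      ... | q∉v , detour e₁ r∈v e₂ , p∉v =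
        bypass-detour p∉v (reversible e₂) r∈v (reversible e₁) q∉v

      bypass-no-u-turn : NoUTurn bypass
      bypass-no-u-turn q e with bypass-just e
      ... | _ , direct e′ , _ = no-u-turn q e′
      ... | _ , detour {r} e₁ _ e₂ , _ = opposite-irreflexive r (just-injective (begin
        just r                     ≡⟨ sym e₁ ⟩
        s q                        ≡⟨ cong s (sym (opposite-involutive q)) ⟩
        s (opposite (opposite q))  ≡⟨ reversible e₂ ⟩
        just (opposite r)          ∎))
        where open ≡-Reasoning

      module Extend (c : Colouring (Graph bypass)) where
        open Colouring c
          renaming (colour to colour′; colour-opposite to colour′-opposite; colour-step to colour′-step)

        exit : Bool → Maybe Port
        exit b = avoid (s (v , b))

        exit-just : ∀ {b r} → exit b ≡ just r → s (v , b) ≡ just r × proj₁ r ≢ v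
        exit-just {b} = avoid-just {s (v , b)}

        exit-off : ∀ {b r} → s (v , b) ≡ just r → proj₁ r ≢ v → exit b ≡ just r
        exit-off e r∉v = trans (cong avoid e) (avoid-off r∉v)

        -- The colour of (v , true): that of the port it leads to, else the opposite of the port
        -- (v , false) leads to, else arbitrary.
        base : Bool
        base = maybe′ colour′ (maybe′ (not ∘ colour′) true (exit false)) (exit true)

        colour : Port → Bool
        colour (x , b) = if does (x ≟ v) then (if b then base else not base) else colour′ (x , b)

        colour-at : ∀ b → colour (v , b) ≡ (if b then base else not base)
        colour-at b with v ≟ v
        ... | yes _   = refl
        ... | no v≢v = contradiction refl v≢v

        colour-opposite : ∀ q → colour (opposite q) ≡ not (colour q)
        colour-opposite (x , b) with x ≟ v
        colour-opposite (x , true)  | yes _ = refl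
        colour-opposite (x , false) | yes _ = sym (Bool.not-involutive base)
        ... | no _ = colour′-opposite (x , b)

        exit-colour : ∀ b {r} → s (v , b) ≡ just r → proj₁ r ≢ v → colour′ r ≡ colour (v , b)
        exit-colour true {r} e r∉v = begin
          colour′ r           ≡⟨ cong (maybe′ colour′ _) (sym (exit-off e r∉v)) ⟩
          base                ≡⟨ sym (colour-at true) ⟩
          colour (v , true)   ∎
          where open ≡-Reasoning
        exit-colour false {r} e r∉v = by-exit-true (exit true) refl
          where
            open ≡-Reasoning
            by-exit-true : ∀ m → exit true ≡ m → colour′ r ≡ colour (v , false)
            by-exit-true (just r′) exit-true = begin
              colour′ r               ≡⟨ colour′-step (bypass-detour r′∉v (reversible e′) refl e r∉v) ⟩
              colour′ (opposite r′)   ≡⟨ colour′-opposite r′ ⟩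
              not (colour′ r′)        ≡⟨ cong (not ∘ maybe′ colour′ _) (sym exit-true) ⟩
              not base                ≡⟨ sym (colour-at false) ⟩
              colour (v , false)      ∎
              where
                e′ = proj₁ (exit-just exit-true)
                r′∉v = proj₂ (exit-just exit-true)
            by-exit-true nothing exit-true = begin
              colour′ r                                       ≡⟨ sym (Bool.not-involutive _) ⟩
              not (not (colour′ r))                           ≡⟨ cong (not ∘ maybe′ (not ∘ colour′) true)
                                                                      (sym (exit-off e r∉v)) ⟩
              not (maybe′ (not ∘ colour′) true (exit false))  ≡⟨ cong (not ∘ maybe′ colour′ _) (sym exit-true) ⟩
              not base                                        ≡⟨ sym (colour-at false) ⟩
              colour (v , false)                              ∎

        colour-step : ∀ {q p} → s q ≡ just p → colour p ≡ colour q
        colour-step {x , b} {y , c} e with x ≟ v | y ≟ v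
        ... | no x∉v   | no y∉v   = colour′-step (bypass-direct x∉v e y∉v)
        ... | yes refl | no y∉v   = trans (exit-colour b e y∉v) (colour-at b)
        ... | no x∉v   | yes refl = trans (sym (colour-at c)) (Bool.not-injective (begin
          not (colour (v , c))      ≡⟨ sym (colour-opposite (v , c)) ⟩
          colour (v , not c)        ≡⟨ sym (exit-colour (not c) (reversible e) x∉v) ⟩
          colour′ (x , not b)       ≡⟨ colour′-opposite (x , b) ⟩
          not (colour′ (x , b))     ∎))
          where open ≡-Reasoning
        colour-step {_ , true}  {_ , true}  e | yes refl | yes refl = refl
        colour-step {_ , false} {_ , false} e | yes refl | yes refl = refl
        colour-step {_ , true}  {_ , false} e | yes refl | yes refl = contradiction e (no-u-turn _)
        colour-step {_ , false} {_ , true}  e | yes refl | yes refl = contradiction e (no-u-turn _)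

        colouring : Colouring (Graph s)
        colouring = record
          { colour = colour ; colour-opposite = colour-opposite ; colour-step = colour-step }

  colouring-exists : (vs : List V) (s : Successor) → Reversible s → NoUTurn s →
                     (∀ {q p} → s q ≡ just p → proj₁ q ∈ vs) → Colouring (Graph s)
  colouring-exists [] s _ _ domain = record
    { colour          = proj₂
    ; colour-opposite = λ _ → refl
    ; colour-step     = λ e → contradiction (domain e) λ ()
    }
  colouring-exists (v ∷ vs) s reversible no-u-turn domain =
    Extend.colouring reversible no-u-turn
      (colouring-exists vs bypass (bypass-reversible reversible no-u-turn)
        (bypass-no-u-turn reversible no-u-turn) domain′)
    where
      open Bypass v s
      domain′ : ∀ {q p} → bypass q ≡ just p → proj₁ q ∈ vs
      domain′ e with bypass-just e
      ... | q∉v , via , _ with domain (proj₂ (via-source via))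
      ...   | here q∈v = contradiction q∈v q∉v
      ...   | there q∈vs = q∈vs

  module _ (_↝_ : Port → Port → Set) (↝-dec : ∀ q → Dec (∃ (q ↝_)))
           (↝-functional : ∀ {q p p′} → q ↝ p → q ↝ p′ → p ≡ p′) where

    next : Successor
    next q with ↝-dec q
    ... | yes (p , _) = just p
    ... | no _        = nothing

    next-sound : ∀ {q p} → next q ≡ just p → q ↝ p
    next-sound {q} e with ↝-dec q
    next-sound refl | yes (_ , q↝p) = q↝p

    next-complete : ∀ {q p} → q ↝ p → next q ≡ just p
    next-complete {q} q↝p with ↝-dec q
    ... | yes (_ , q↝p′) = cong just (↝-functional q↝p′ q↝p)
    ... | no ∄p          = contradiction (_ , q↝p) ∄p

    relation-colouring : (vs : List V) → (∀ x → x ∈ vs) →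
      (∀ {q p} → q ↝ p → opposite p ↝ opposite q) → (∀ q → ¬ q ↝ opposite q) →
      Colouring _↝_
    relation-colouring vs complete reverse no-u-turn = record
      { colour          = colour
      ; colour-opposite = colour-opposite
      ; colour-step     = colour-step ∘ next-complete
      }
      where
        open Colouring (colouring-exists vs next
          (next-complete ∘ reverse ∘ next-sound)
          (λ q → no-u-turn q ∘ next-sound)
          (λ {q} _ → complete (proj₁ q)))

module Orientation (G : FinDigraph) where

  Vertex : Set
  Vertex = Fin (n G)

  adj : Bool → Vertex → Vertex → Bool
  adj true  x y = arc G x y
  adj false x y = arc G y x

  deg : Bool → Vertex → ℕ
  deg b x = length (Selected (adj b x))

  data Adj : Bool → Vertex → Vertex → Set where
    arc⁺ : ∀ {x y} → T (arc G x y) → Adj true  x y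
    arc⁻ : ∀ {x y} → T (arc G y x) → Adj false x y

  Adj⇒adj : ∀ {b x y} → Adj b x y → T (adj b x y)
  Adj⇒adj (arc⁺ a) = a
  Adj⇒adj (arc⁻ a) = a

  adj⇒Adj : ∀ b {x y} → T (adj b x y) → Adj b x y
  adj⇒Adj true  = arc⁺
  adj⇒Adj false = arc⁻

  Adj? : ∀ b x y → Dec (Adj b x y)
  Adj? b x y = Dec.map′ (adj⇒Adj b) Adj⇒adj (T? (adj b x y))

  Adj-converse : ∀ {b x y} → Adj b x y → Adj (not b) y x
  Adj-converse (arc⁺ a) = arc⁻ a
  Adj-converse (arc⁻ a) = arc⁺ a

  deg≡2⇒two-neighbours : ∀ {b x} → deg b x ≡ 2 → ∃₂ λ y z → y ≢ z × Adj b x y × Adj b x z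
  deg≡2⇒two-neighbours {b} {x} d with length≡2⇒two-members (selected-unique (adj b x)) d
  ... | y , z , y≢z , y∈ , z∈ =
    y , z , y≢z , adj⇒Adj b (selected-satisfies (adj b x) y∈) ,
                  adj⇒Adj b (selected-satisfies (adj b x) z∈)

  ∈-neighbours : ∀ {b x y} → Adj b x y → y ∈ Selected (adj b x)
  ∈-neighbours {b} {x} a = ∈-selected (adj b x) (Adj⇒adj a)

  common-neighbour : ∀ {b s u v} → Adj b s u → Adj b s v →
                     (T (arc G u s) × T (arc G v s)) ⊎ (T (arc G s u) × T (arc G s v))
  common-neighbour (arc⁺ a) (arc⁺ a′) = inj₂ (a , a′)
  common-neighbour (arc⁻ a) (arc⁻ a′) = inj₁ (a , a′)

  module _ (deg≤2 : ∀ b x → deg b x ≤ 2) where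

    two-neighbours⇒deg≡2 : ∀ {b x y z} → y ≢ z → Adj b x y → Adj b x z → deg b x ≡ 2
    two-neighbours⇒deg≡2 {b} {x} y≢z ay az =
      ≤-antisym (deg≤2 b x) (two≤length (∈-neighbours ay) (∈-neighbours az) y≢z)

    at-most-two-neighbours : ∀ {b x y z w} → Adj b x y → Adj b x z → Adj b x w →
                             y ≢ z → y ≢ w → z ≡ w
    at-most-two-neighbours {b} {x} {z = z} {w} ay az aw y≢z y≢w with z ≟ w
    ... | yes z≡w = z≡w
    ... | no z≢w  = contradiction
      (three≤length (∈-neighbours ay) (∈-neighbours az) (∈-neighbours aw) y≢z y≢w z≢w) (≤⇒≯ (deg≤2 b x))

module Algorithm (G : FinDigraph) where
  open Orientation G

  initial-excluded : ∀ {x c} → initial G x c ≡ false → ∃ λ b → deg b x ≡ 2 × c ≢ t[ b ]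
  initial-excluded {x} e with outdeg G x ≡ᵇ 2 in out₂
  ... | true  = true , ≡ᵇ-true out₂ , is-false e
  ... | false with indeg G x ≡ᵇ 2 in in₂
  ...   | true = false , ≡ᵇ-true in₂ , is-false e

  deg≡2⇒initial-excludes : ∀ {b x} → deg b x ≡ 2 → ∃ λ c → initial G x c ≡ false
  deg≡2⇒initial-excludes {b} {x} d with outdeg G x ≡ᵇ 2 in out₂
  ... | true  = t₁ , refl
  deg≡2⇒initial-excludes {true} d | false = contradiction d (≡ᵇ-false out₂)
  deg≡2⇒initial-excludes {false} {x} d | false with indeg G x ≡ᵇ 2 in in₂
  ...   | true  = t₀ , refl
  ...   | false = contradiction d (≡ᵇ-false in₂)

  singleton? : (ℓ : State G) → ∀ y c → Dec (Singleton {G} ℓ y c)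
  singleton? ℓ y c = (ℓ y c Bool.≟ true) ×-dec (ℓ y (other c) Bool.≟ false)

  removable? : (ℓ : State G) → ∀ x c → Dec (Removable G ℓ x c)
  removable? ℓ x c with by-arc c | by-sibling
    where
      ByArc : Fin 2 → Set
      ByArc 0F = ∃ λ y → Singleton {G} ℓ y t₁ × T (arc G y x)
      ByArc 1F = ∃ λ y → Singleton {G} ℓ y t₀ × T (arc G x y)

      by-arc : ∀ c → Dec (ByArc c)
      by-arc 0F = any? λ y → singleton? ℓ y t₁ ×-dec T? (arc G y x)
      by-arc 1F = any? λ y → singleton? ℓ y t₀ ×-dec T? (arc G x y)

      by-sibling : Dec (∃₂ λ y s → x ≢ y × Singleton {G} ℓ y c ×
                         ((T (arc G x s) × T (arc G y s)) ⊎ (T (arc G s x) × T (arc G s y))))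
      by-sibling = any? λ y → any? λ s → ¬? (x ≟ y) ×-dec singleton? ℓ y c ×-dec
                     ((T? (arc G x s) ×-dec T? (arc G y s)) ⊎-dec (T? (arc G s x) ×-dec T? (arc G s y)))
  removable? ℓ x 0F | yes (y , sy , a) | _ = yes (rule2 x y sy a)
  removable? ℓ x 1F | yes (y , sy , a) | _ = yes (rule1 x y sy a)
  ... | no _ | yes (y , s , x≢y , sy , common) = yes (rule3 x y s c x≢y sy common)
  removable? ℓ x 0F | no ∄arc | no ∄sibling = no λ
    { (rule2 _ y sy a)                → ∄arc (y , sy , a)
    ; (rule3 _ y s _ x≢y sy common)   → ∄sibling (y , s , x≢y , sy , common) }
  removable? ℓ x 1F | no ∄arc | no ∄sibling = no λ
    { (rule1 _ y sy a)                → ∄arc (y , sy , a)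
    ; (rule3 _ y s _ x≢y sy common)   → ∄sibling (y , s , x≢y , sy , common) }

  size : State G → ℕ
  size ℓ = ∑ λ x → ∑ λ c → ⟦ ℓ x c ⟧

  remove-⊆ : ∀ (ℓ : State G) x c y d → remove {G} ℓ x c y d ≡ true → ℓ y d ≡ true
  remove-⊆ ℓ x c y d e with does (y ≟ x) ∧ does (d ≟ c)
  ... | false = e

  ⟦remove⟧≤ : ∀ (ℓ : State G) x c y d → ⟦ remove {G} ℓ x c y d ⟧ ≤ ⟦ ℓ y d ⟧
  ⟦remove⟧≤ ℓ x c y d with does (y ≟ x) ∧ does (d ≟ c)
  ... | true  = z≤n
  ... | false = ≤-refl

  remove-removes : ∀ (ℓ : State G) x c → remove {G} ℓ x c x c ≡ false
  remove-removes ℓ x c with x ≟ x | c ≟ c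
  ... | yes _ | yes _ = refl
  ... | no x≢x | _ = contradiction refl x≢x
  ... | yes _ | no c≢c = contradiction refl c≢c

  size-remove : ∀ {ℓ : State G} {x c} → ℓ x c ≡ true → size (remove {G} ℓ x c) < size ℓ
  size-remove {ℓ} {x} {c} e =
    ∑-mono-< (λ y → ∑-mono-≤ (⟦remove⟧≤ ℓ x c y)) x
      (∑-mono-< (⟦remove⟧≤ ℓ x c x) c
        (subst₂ (λ r l → ⟦ r ⟧ < ⟦ l ⟧) (sym (remove-removes ℓ x c)) (sym e) ≤-refl))

  run-⊆ : ∀ {ℓ ℓ′ : State G} → Star (Step G) ℓ ℓ′ → ∀ x c → ℓ′ x c ≡ true → ℓ x c ≡ true
  run-⊆ ε x c e = e
  run-⊆ (step ℓ y d _ _ ◅ steps) x c e = remove-⊆ ℓ y d x c (run-⊆ steps x c e)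

  module _ (Inv : State G → Set) (Inv⇒NoEmpty : ∀ {ℓ} → Inv ℓ → NoEmpty {G} ℓ)
           (Inv-remove : ∀ {ℓ x c} → Inv ℓ → Removable G ℓ x c → Inv (remove {G} ℓ x c)) where

    run-to-stable : ∀ ℓ → Inv ℓ → Σ (State G) λ ℓ′ → Star (Step G) ℓ ℓ′ × Stable {G} ℓ′ × Inv ℓ′
    run-to-stable ℓ = go ℓ (<-wellFounded (size ℓ))
      where
        go : ∀ ℓ → Acc _<_ (size ℓ) → Inv ℓ →
             Σ (State G) λ ℓ′ → Star (Step G) ℓ ℓ′ × Stable {G} ℓ′ × Inv ℓ′
        go ℓ (acc smaller) inv with any? (λ x → any? (λ c → removable? ℓ x c ×-dec (ℓ x c Bool.≟ true)))
        ... | no none = ℓ , ε , (λ x c r → Bool.¬-not λ e → none (x , c , r , e)) , inv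
        ... | yes (x , c , r , e)
          with go (remove {G} ℓ x c) (smaller (size-remove {ℓ} {x} {c} e)) (Inv-remove inv r)
        ...   | ℓ′ , steps , stable , inv′ = ℓ′ , step ℓ x c (Inv⇒NoEmpty inv) r ◅ steps , stable , inv′

module Soundness (G : FinDigraph) (φ : IosInjHom (toDigraph G) T2r) where
  open Orientation G
  open Algorithm G
  open IosInjHom φ

  Admits : State G → Set
  Admits ℓ = ∀ x → ℓ x (f x) ≡ true

  image-trapped : ∀ {b x y} → Adj b x y → f x ≡ t[ not b ] → f y ≡ t[ not b ]
  image-trapped (arc⁺ a) fx = ≢⇒≡other λ fy → T2r-no-t₁t₀ fx fy (hom a)
  image-trapped (arc⁻ a) fx = ≢⇒≡other λ fy → T2r-no-t₁t₀ fy fx (hom a)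

  nbhd-injective : ∀ {b x y z} → Adj b x y → Adj b x z → f y ≡ f z → y ≡ z
  nbhd-injective (arc⁺ a) (arc⁺ a′) = outInj _ _ _ a a′
  nbhd-injective (arc⁻ a) (arc⁻ a′) = inInj  _ _ _ a a′

  deg≡2⇒image : ∀ b x → deg b x ≡ 2 → f x ≡ t[ b ]
  deg≡2⇒image b x d with f x ≟ t[ b ] | deg≡2⇒two-neighbours {b} {x} d
  ... | yes fx≡t[b] | _ = fx≡t[b]
  ... | no fx≢t[b]  | y , z , y≢z , ay , az = contradiction
    (nbhd-injective ay az (trans (image-trapped ay fx≡t[¬b]) (sym (image-trapped az fx≡t[¬b])))) y≢z
    where fx≡t[¬b] = ≢t[]⇒≡t[not] b fx≢t[b]

  module _ {ℓ : State G} (adm : Admits ℓ) where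

    admitted-singleton : ∀ {y c} → Singleton {G} ℓ y c → f y ≡ c
    admitted-singleton {y} {c} (_ , other-excluded) with f y ≟ c
    ... | yes fy≡c = fy≡c
    ... | no fy≢c  = contradiction
      (trans (sym (subst (λ d → ℓ y d ≡ true) (≢⇒≡other fy≢c) (adm y))) other-excluded) true≢false

    removable-excludes-image : ∀ {x c} → Removable G ℓ x c → f x ≢ c
    removable-excludes-image (rule1 x y sy a) fx≡t₁ = T2r-no-t₁t₀ fx≡t₁ (admitted-singleton sy) (hom a)
    removable-excludes-image (rule2 x y sy a) fx≡t₀ = T2r-no-t₁t₀ (admitted-singleton sy) fx≡t₀ (hom a)
    removable-excludes-image (rule3 x y s c x≢y sy (inj₁ (a , a′))) fx≡c =
      x≢y (inInj s x y a a′ (trans fx≡c (sym (admitted-singleton sy))))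
    removable-excludes-image (rule3 x y s c x≢y sy (inj₂ (a , a′))) fx≡c =
      x≢y (outInj s x y a a′ (trans fx≡c (sym (admitted-singleton sy))))

    remove-admits : ∀ {x c} → Removable G ℓ x c → Admits (remove {G} ℓ x c)
    remove-admits {x} {c} r y with y ≟ x | f y ≟ c
    ... | yes refl | yes fy≡c = contradiction fy≡c (removable-excludes-image r)
    ... | yes refl | no _     = adm y
    ... | no _     | _        = adm y

  initial-admits : Admits (initial G)
  initial-admits x = Bool.¬-not λ excluded →
    let b , d , fx≢ = initial-excluded excluded in fx≢ (deg≡2⇒image b x d)

  succeeds : CCASucceeds G
  succeeds
    with run-to-stable Admits (λ adm x → f x , adm x) (λ adm → remove-admits adm) (initial G) initial-admits
  ... | ℓ , steps , stable , adm = ℓ , steps , stable , λ x → f x , adm x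

module Completeness (G : FinDigraph) (deg≤2 : ∀ b x → Orientation.deg G b x ≤ 2)
                    (ℓ : State G) (run : Star (Step G) (initial G) ℓ)
                    (stable : Stable {G} ℓ) (nonempty : NoEmpty {G} ℓ) where
  open Orientation G
  open Algorithm G
  open PortColouring {Vertex} _≟_

  Full : Vertex → Set
  Full x = ∀ c → ℓ x c ≡ true

  full? : ∀ x → Dec (Full x)
  full? x = all? λ c → ℓ x c Bool.≟ true

  full⇒deg≢2 : ∀ {b x} → Full x → deg b x ≢ 2
  full⇒deg≢2 {b} {x} full d with deg≡2⇒initial-excludes {b} d
  ... | c , excluded = true≢false (trans (sym (run-⊆ run x c (full c))) excluded)

  full-unique-neighbour : ∀ {b x y z} → Full x → Adj b x y → Adj b x z → y ≡ z
  full-unique-neighbour {b} {y = y} {z} full ay az with y ≟ z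
  ... | yes y≡z = y≡z
  ... | no y≢z  = contradiction (two-neighbours⇒deg≡2 deg≤2 y≢z ay az) (full⇒deg≢2 {b} full)

  at-most-two-siblings : ∀ {b w x y z} → Adj b x w → Adj b y w → Adj b z w →
                         x ≢ y → x ≢ z → y ≡ z
  at-most-two-siblings ax ay az =
    at-most-two-neighbours deg≤2 (Adj-converse ax) (Adj-converse ay) (Adj-converse az)

  -- (x , true) and (x , false) are the out-side and the in-side of x. A link ties the colours of
  -- two full vertices, along an arc or across a common neighbour that is not full; the latter
  -- changes side.
  data Link : Port → Port → Set where
    along  : ∀ {b x y} → Full x → Adj b x y → Full y → Link (x , b) (y , b)
    across : ∀ {b x w y} → Full x → Adj b x w → ¬ Full w → Adj b y w → y ≢ x → Full y →
             Link (x , b) (y , not b)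

  link-functional : ∀ {q p p′} → Link q p → Link q p′ → p ≡ p′
  link-functional (along fx a _) (along _ a′ _) = cong (_, _) (full-unique-neighbour fx a a′)
  link-functional (along fx a fy) (across _ a′ ¬fw _ _ _) =
    contradiction (subst Full (full-unique-neighbour fx a a′) fy) ¬fw
  link-functional (across _ a ¬fw _ _ _) (along fx a′ fy) =
    contradiction (subst Full (full-unique-neighbour fx a′ a) fy) ¬fw
  link-functional (across fx a _ ay y≢x _) (across _ a′ _ ay′ y′≢x _) with full-unique-neighbour fx a a′
  ... | refl = cong (_, _) (at-most-two-siblings a ay ay′ (y≢x ∘ sym) (y′≢x ∘ sym))

  link? : ∀ q → Dec (∃ (Link q))
  link? (x , b) with any? (λ y → full? x ×-dec Adj? b x y ×-dec full? y)
                   | any? (λ w → any? λ y → full? x ×-dec Adj? b x w ×-dec ¬? (full? w) ×-dec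
                                             Adj? b y w ×-dec ¬? (y ≟ x) ×-dec full? y)
  ... | yes (_ , fx , a , fy) | _ = yes (_ , along fx a fy)
  ... | no _ | yes (_ , _ , fx , a , ¬fw , ay , y≢x , fy) = yes (_ , across fx a ¬fw ay y≢x fy)
  ... | no ∄along | no ∄across = no λ
    { (_ , along fx a fy)               → ∄along (_ , fx , a , fy)
    ; (_ , across fx a ¬fw ay y≢x fy)   → ∄across (_ , _ , fx , a , ¬fw , ay , y≢x , fy) }

  link-reverse : ∀ {q p} → Link q p → Link (opposite p) (opposite q)
  link-reverse (along fx a fy) = along fy (Adj-converse a) fx
  link-reverse {_ , true}  (across fx a ¬fw ay y≢x fy) = across fy ay ¬fw a (y≢x ∘ sym) fx
  link-reverse {_ , false} (across fx a ¬fw ay y≢x fy) = across fy ay ¬fw a (y≢x ∘ sym) fx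

  link-no-u-turn : ∀ q → ¬ Link q (opposite q)
  link-no-u-turn (_ , true)  (across _ _ _ _ x≢x _) = x≢x refl
  link-no-u-turn (_ , false) (across _ _ _ _ x≢x _) = x≢x refl

  open Colouring
    (relation-colouring Link link? link-functional (allFin _) ∈-allFin link-reverse link-no-u-turn)

  same-side : ∀ b {x y} → colour (y , b) ≡ colour (x , b) → colour (y , true) ≡ colour (x , true)
  same-side true  e = e
  same-side false {x} {y} e =
    Bool.not-injective (trans (sym (colour-opposite (y , true))) (trans e (colour-opposite (x , true))))

  opposite-side : ∀ b {x y} → colour (y , not b) ≡ colour (x , b) →
                  colour (y , true) ≢ colour (x , true)
  opposite-side true {x} {y} e e′ =
    Bool.not-¬ refl (trans e′ (sym (trans (sym (colour-opposite (y , true))) e)))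
  opposite-side false {x} {y} e e′ =
    Bool.not-¬ refl (trans (sym e′) (trans e (colour-opposite (x , true))))

  data Kind (x : Vertex) : Set where
    full   : Full x → Kind x
    single : ∀ c → Singleton {G} ℓ x c → Kind x

  kind : ∀ x → Kind x
  kind x with ℓ x t₀ in e₀ | ℓ x t₁ in e₁
  ... | true  | true  = full λ { 0F → e₀ ; 1F → e₁ }
  ... | true  | false = single t₀ (e₀ , e₁)
  ... | false | true  = single t₁ (e₁ , e₀)
  ... | false | false with nonempty x
  ...   | 0F , e = contradiction (trans (sym e) e₀) true≢false
  ...   | 1F , e = contradiction (trans (sym e) e₁) true≢false

  full-not-singleton : ∀ {x c} → Full x → ¬ Singleton {G} ℓ x c
  full-not-singleton {c = c} fx (_ , other-excluded) =
    true≢false (trans (sym (fx (other c))) other-excluded)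

  singleton-unique : ∀ {x c d} → Singleton {G} ℓ x c → Singleton {G} ℓ x d → c ≡ d
  singleton-unique {c = c} {d} (c-listed , _) (_ , other-excluded) with c ≟ d
  ... | yes c≡d = c≡d
  ... | no c≢d  = contradiction
    (trans (sym (subst (λ e → ℓ _ e ≡ true) (≢⇒≡other c≢d) c-listed)) other-excluded) true≢false

  colourOfKind : ∀ {x} → Kind x → Fin 2
  colourOfKind {x} (full _)     = t[ colour (x , true) ]
  colourOfKind     (single c _) = c

  colourOf : Vertex → Fin 2
  colourOf x = colourOfKind (kind x)

  colourOf-listed : ∀ x → ℓ x (colourOf x) ≡ true
  colourOf-listed x = listed (kind x)
    where
      listed : (k : Kind x) → ℓ x (colourOfKind k) ≡ true
      listed (full fx)                 = fx _
      listed (single _ (c-listed , _)) = c-listed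

  colourOf-single : ∀ {x c} → Singleton {G} ℓ x c → colourOf x ≡ c
  colourOf-single {x} sx with kind x
  ... | full fx       = contradiction sx (full-not-singleton fx)
  ... | single _ sx′  = singleton-unique sx′ sx

  colourOf-full : ∀ {x} → Full x → colourOf x ≡ t[ colour (x , true) ]
  colourOf-full {x} fx with kind x
  ... | full _       = refl
  ... | single _ sx  = contradiction sx (full-not-singleton fx)

  singleton-colour : ∀ {x c d} → Singleton {G} ℓ x c → colourOf x ≡ d → Singleton {G} ℓ x d
  singleton-colour sx e = subst (Singleton {G} ℓ _) (trans (sym (colourOf-single sx)) e) sx

  removable-not-colour : ∀ {x c} → Removable G ℓ x c → colourOf x ≢ c
  removable-not-colour {x} {c} r refl = true≢false (trans (sym (colourOf-listed x)) (stable x c r))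

  along-colour : ∀ {b x y} → Full x → Adj b x y → Full y → colourOf y ≡ colourOf x
  along-colour {b} {x} {y} fx a fy = begin
    colourOf y              ≡⟨ colourOf-full fy ⟩
    t[ colour (y , true) ]  ≡⟨ cong t[_] (same-side b (colour-step (along fx a fy))) ⟩
    t[ colour (x , true) ]  ≡⟨ colourOf-full fx ⟨
    colourOf x              ∎
    where open ≡-Reasoning

  across-colour : ∀ {b x w y} → Full x → Adj b x w → ¬ Full w → Adj b y w → y ≢ x → Full y →
                  colourOf y ≢ colourOf x
  across-colour {b} fx a ¬fw ay y≢x fy e =
    opposite-side b (colour-step (across fx a ¬fw ay y≢x fy))
      (t[]-injective (trans (sym (colourOf-full fy)) (trans e (colourOf-full fx))))

  colourOf-hom : ∀ {x y} → T (arc G x y) → T (T2r-arc (colourOf x) (colourOf y))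
  colourOf-hom {x} {y} a = T2r-arc-unless-t₁t₀ (no-t₁t₀ (kind x) (kind y))
    where
      no-t₁t₀ : Kind x → Kind y → colourOf x ≡ t₁ → colourOf y ≢ t₀
      no-t₁t₀ (single _ sx) _ x↦t₁ = removable-not-colour (rule2 y x (singleton-colour sx x↦t₁) a)
      no-t₁t₀ _ (single _ sy) x↦t₁ y↦t₀ = removable-not-colour (rule1 x y (singleton-colour sy y↦t₀) a) x↦t₁
      no-t₁t₀ (full fx) (full fy) x↦t₁ y↦t₀
        with () ← trans (sym y↦t₀) (trans (along-colour fx (arc⁺ a) fy) x↦t₁)

  colourOf-injective : ∀ {b x y z} → Adj b x y → Adj b x z → colourOf y ≡ colourOf z → y ≡ z
  colourOf-injective {b} {x} {y} {z} ay az e with y ≟ z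
  ... | yes y≡z = y≡z
  ... | no y≢z  = ⊥-elim (clash (kind x) (kind y) (kind z))
    where
      clash : Kind x → Kind y → Kind z → ⊥
      clash _ (single c sy) _ =
        removable-not-colour (rule3 z y x c (y≢z ∘ sym) sy (common-neighbour az ay))
          (trans (sym e) (colourOf-single sy))
      clash _ _ (single c sz) =
        removable-not-colour (rule3 y z x c y≢z sz (common-neighbour ay az)) (trans e (colourOf-single sz))
      clash (full fx) (full _) (full _) = y≢z (full-unique-neighbour fx ay az)
      clash (single _ sx) (full fy) (full fz) =
        across-colour fy (Adj-converse ay) (λ fx → full-not-singleton fx sx) (Adj-converse az)
          (y≢z ∘ sym) fz (sym e)

  homomorphism : IosInjHom (toDigraph G) T2r
  homomorphism = record
    { f      = colourOf
    ; hom    = colourOf-hom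
    ; inInj  = λ _ _ _ a a′ → colourOf-injective (arc⁻ a) (arc⁻ a′)
    ; outInj = λ _ _ _ a a′ → colourOf-injective (arc⁺ a) (arc⁺ a′)
    }

proposition4p2 : (G : FinDigraph) → IrreflexiveOriented G →
    (∀ x → indeg G x ≤ 2) → (∀ x → outdeg G x ≤ 2) →
    ¬ IosInjHom H4 (toDigraph G) → ¬ IosInjHom H4c (toDigraph G) →
    ¬ IosInjHom X2 (toDigraph G) →
    CCASucceeds G ⇔ IosInjHom (toDigraph G) T2r
proposition4p2 G _ indeg≤2 outdeg≤2 _ _ _ = mk⇔
  (λ (ℓ , run , stable , nonempty) → Completeness.homomorphism G deg≤2 ℓ run stable nonempty)
  (Soundness.succeeds G)
  where
    deg≤2 : ∀ b x → Orientation.deg G b x ≤ 2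
    deg≤2 true  = outdeg≤2
    deg≤2 false = indeg≤2
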